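{- Let $\phi$ be a RoCTL*$_{\mathbf v}$ formula and $\phi^\star$ a QCTL* formula such that $M,\sigma\vDash\phi$ iff $M,\sigma\vDash^\star\phi^\star$ for all tree RoCTL-structures $M$ and fullpaths $\sigma$ through $M$. Then for all tree RoCTL-structures $M$ and fullpaths $\sigma$ through $M$: $$M,\sigma\vDash O\phi \iff M,\sigma\vDash^\star A(NG\neg\mathbf v\rightarrow\phi^\star).$$
   Context: Fix a set $\mathcal V$ of atoms containing a distinguished atom $\mathbf v$. A structure $M=(S,R,g)$ has a nonempty set $S$, a serial relation $R$ on $S$, and a valuation $g:S\to2^{\mathcal V}$. A fullpath is an infinite $R$-chain $\sigma=\langle\sigma_0,\sigma_1,\dots\rangle$, with suffixes $\sigma_{\ge i}$ and prefixes $\sigma_{\le i}$. A fullpath is failure-free if $\mathbf v\notin g(\sigma_i)$ for all $i>0$. $ap(w)$ and $sp(w)$ are the sets of all, respectively all failure-free, fullpaths from $w$. $M$ is a RoCTL-structure if $sp(w)\neq\emptyset$ for all $w$. A deviation from $\sigma$ is a fullpath $\pi$ with $\pi_{\le i}=\sigma_{\le i}$ and $\pi_{\ge i+1}$ failure-free for some $i\ge0$. RoCTL*$_{\mathbf v}$ formulas: $\phi::=p\mid\neg\phi\mid\phi\wedge\phi\mid\phi U\phi\mid N\phi\mid A\phi\mid O\phi\mid\blacktriangle\phi$, with $p\in\mathcal V$. They are evaluated on fullpaths: - $N$ and $U$ are the usual next and until; - $A\phi$: $\phi$ holds on all fullpaths from $\sigma_0$; - $O\phi$: $\phi$ holds on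 all failure-free fullpaths from $\sigma_0$; - $\blacktriangle\phi$: $\phi$ holds on $\sigma$ and on all deviations from $\sigma$. A tree structure has a unique root from which all nodes are reachable, unique predecessors for non-root nodes, and no cycles. QCTL* extends CTL* by $\forall p\,\phi$. $\vDash^\star$ is its tree semantics, with $\forall p\,\alpha$ true on $\sigma$ iff $\alpha$ is true on $\sigma$ in every $p$-variant (valuation changed only on $p$) of the tree structure. $G\psi=\neg(\top U\neg\psi)$. -}

module Defs where

open import Data.Nat using (ℕ; zero; suc; _+_; _<_; _≤_)
open import Data.Bool using (Bool; true; false)
open import Data.Product using (Σ; ∃; _×_; _,_; proj₁; proj₂)
open import Relation.Binary.PropositionalEquality using (_≡_; _≢_)
open import Relation.Nullary using (¬_)

-- Structures M = (S, R, g) over a set of atoms V.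
-- Valuation g : S → 2^V is rendered as S → V → Bool.

record Structure (V : Set) : Set₁ where
  field
    S      : Set
    R      : S → S → Set
    serial : ∀ s → ∃ λ t → R s t
    g      : S → V → Bool

open Structure public

module _ {V : Set} where

  record Path (M : Structure V) : Set where
    constructor path
    field
      seq  : ℕ → S M
      step : ∀ i → R M (seq i) (seq (suc i))

  _at_ : {M : Structure V} → Path M → ℕ → S M
  σ at i = Path.seq σ i

  suffix : {M : Structure V} → Path M → ℕ → Path M
  suffix (path σ r) k = path (λ i → σ (i + k)) (λ i → r (i + k))

  FailureFree : (v : V) (M : Structure V) → Path M → Set
  FailureFree v M σ = ∀ i → 0 < i → g M (σ at i) v ≡ false

  Deviation : (v : V) (M : Structure V) → Path M → Path M → Set
  Deviation v M σ π =
    ∃ λ i → (∀ j → j ≤ i → π at j ≡ σ at j) × FailureFree v M (suffix π (suc i))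

  IsRoCTL : (v : V) → Structure V → Set
  IsRoCTL v M = ∀ w → ∃ λ (π : Path M) → (π at 0 ≡ w) × FailureFree v M π

  data Reach (M : Structure V) : S M → S M → Set where
    here : ∀ {s} → Reach M s s
    step : ∀ {s t u} → R M s t → Reach M t u → Reach M s u

  IsTree : Structure V → Set
  IsTree M = Σ (S M) λ r →
      (∀ s → Reach M r s)
    × (∀ r' → (∀ s → Reach M r' s) → r' ≡ r)
    × (∀ s → s ≢ r → Σ (S M) λ p → R M p s × (∀ p' → R M p' s → p' ≡ p))
    × (∀ s t → R M s t → ¬ Reach M t s)

  Variant : (M : Structure V) → V → (S M → V → Bool) → Set
  Variant M p g' = ∀ s q → q ≢ p → g' s q ≡ g M s q

  _with-g_ : (M : Structure V) → (S M → V → Bool) → Structure V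
  M with-g g' = record M { g = g' }

  revalue : {M : Structure V} (g' : S M → V → Bool) → Path M → Path (M with-g g')
  revalue g' (path σ r) = path σ r

data RForm (V : Set) : Set where
  r-atom  : V → RForm V
  r-not   : RForm V → RForm V
  r-and   : RForm V → RForm V → RForm V
  r-until : RForm V → RForm V → RForm V
  r-next  : RForm V → RForm V
  r-A     : RForm V → RForm V
  r-O     : RForm V → RForm V
  r-rob   : RForm V → RForm V

data QForm (V : Set) : Set where
  q-atom   : V → QForm V
  q-not    : QForm V → QForm V
  q-and    : QForm V → QForm V → QForm V
  q-until  : QForm V → QForm V → QForm V
  q-next   : QForm V → QForm V
  q-A      : QForm V → QForm V
  q-forall : V → QForm V → QForm V

q-true : {V : Set} → V → QForm V
q-true p = q-not (q-and (q-atom p) (q-not (q-atom p)))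

q-imp : {V : Set} → QForm V → QForm V → QForm V
q-imp φ ψ = q-not (q-and φ (q-not ψ))

q-G : {V : Set} → V → QForm V → QForm V
q-G p ψ = q-not (q-until (q-true p) (q-not ψ))

-- Semantics.  Existentials of the until clause are double-negated
-- (classically equivalent).

module _ {V : Set} where

  Sat : (v : V) (M : Structure V) → Path M → RForm V → Set
  Sat v M σ (r-atom p)    = g M (σ at 0) p ≡ true
  Sat v M σ (r-not φ)     = ¬ Sat v M σ φ
  Sat v M σ (r-and φ ψ)   = Sat v M σ φ × Sat v M σ ψ
  Sat v M σ (r-until φ ψ) =
    ¬ ¬ (∃ λ j → Sat v M (suffix σ j) ψ × (∀ i → i < j → Sat v M (suffix σ i) φ))
  Sat v M σ (r-next φ)    = Sat v M (suffix σ 1) φ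
  Sat v M σ (r-A φ)       = ∀ (π : Path M) → π at 0 ≡ σ at 0 → Sat v M π φ
  Sat v M σ (r-O φ)       =
    ∀ (π : Path M) → π at 0 ≡ σ at 0 → FailureFree v M π → Sat v M π φ
  Sat v M σ (r-rob φ)     =
    Sat v M σ φ × (∀ (π : Path M) → Deviation v M σ π → Sat v M π φ)

  Sat⋆ : (M : Structure V) → Path M → QForm V → Set
  Sat⋆ M σ (q-atom p)     = g M (σ at 0) p ≡ true
  Sat⋆ M σ (q-not φ)      = ¬ Sat⋆ M σ φ
  Sat⋆ M σ (q-and φ ψ)    = Sat⋆ M σ φ × Sat⋆ M σ ψ
  Sat⋆ M σ (q-until φ ψ)  =
    ¬ ¬ (∃ λ j → Sat⋆ M (suffix σ j) ψ × (∀ i → i < j → Sat⋆ M (suffix σ i) φ))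
  Sat⋆ M σ (q-next φ)     = Sat⋆ M (suffix σ 1) φ
  Sat⋆ M σ (q-A φ)        = ∀ (π : Path M) → π at 0 ≡ σ at 0 → Sat⋆ M π φ
  Sat⋆ M σ (q-forall p φ) =
    ∀ (g' : S M → V → Bool) → Variant M p g' → Sat⋆ (M with-g g') (revalue g' σ) φ

module Submission where

-- O φ says that φ holds on every failure-free fullpath
-- from σ₀, while A(NG¬v → φ⋆) says that φ⋆ holds on every fullpath from σ₀
-- satisfying NG¬v.  So the theorem follows from three facts:
--   (1) a fullpath satisfies NG¬v exactly when it is failure-free
--       (failure-freeness only constrains positions i > 0, hence the N);
--   (2) by hypothesis, φ and φ⋆ agree on every fullpath of a tree
--       RoCTL-structure;
--   (3) RoCTL* satisfaction is stable under double negation.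
-- Fact (3) is needed because the semantics is constructive: the QCTL*
-- implication a → b is encoded as ¬(a ∧ ¬b), which only yields ¬¬b, and G
-- is encoded through a double-negated until.

open import Defs
open import Data.Product using (_×_; _,_; proj₁; proj₂)
open import Data.Nat using (ℕ; zero; suc; _+_; s≤s; z≤n)
open import Data.Nat.Properties using (+-comm)
open import Data.Bool using (true; _≟_)
open import Data.Bool.Properties using (¬-not; not-¬)
open import Relation.Nullary
  using (¬_; Stable; negated-stable; decidable-stable)
open import Relation.Nullary.Negation using (¬¬-map)
open import Relation.Binary.PropositionalEquality using (_≡_; cong; trans; sym)

×-stable : {A B : Set} → Stable A → Stable B → Stable (A × B)
×-stable stableA stableB ¬¬ab =
  stableA (¬¬-map proj₁ ¬¬ab) , stableB (¬¬-map proj₂ ¬¬ab)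

Π-stable : {A : Set} {B : A → Set} → (∀ a → Stable (B a)) → Stable (∀ a → B a)
Π-stable stableB ¬¬f a = stableB a (¬¬-map (λ f → f a) ¬¬f)

-- (3) Every RoCTL*_v formula has a ¬¬-stable satisfaction relation, on any
-- structure: atoms are decidable, and every other clause is built from
-- negations, products and universal quantifiers over stable parts.
sat-stable : {V : Set} (v : V) (M : Structure V) (φ : RForm V) (σ : Path M)
  → Stable (Sat v M σ φ)
sat-stable v M (r-atom p)    σ = decidable-stable (Structure.g M (σ at 0) p ≟ true)
sat-stable v M (r-not φ)     σ = negated-stable
sat-stable v M (r-and φ ψ)   σ = ×-stable (sat-stable v M φ σ) (sat-stable v M ψ σ)
sat-stable v M (r-until φ ψ) σ = negated-stable
sat-stable v M (r-next φ)    σ = sat-stable v M φ (suffix σ 1)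
sat-stable v M (r-A φ)       σ =
  Π-stable λ π → Π-stable λ _ → sat-stable v M φ π
sat-stable v M (r-O φ)       σ =
  Π-stable λ π → Π-stable λ _ → Π-stable λ _ → sat-stable v M φ π
sat-stable v M (r-rob φ)     σ =
  ×-stable (sat-stable v M φ σ) (Π-stable λ π → Π-stable λ _ → sat-stable v M φ π)

NG¬ : {V : Set} → V → QForm V
NG¬ v = q-next (q-G v (q-not (q-atom v)))

module _ {V : Set} {M : Structure V} where

  true-holds : (p : V) (σ : Path M) → Sat⋆ M σ (q-true p)
  true-holds p σ (p-holds , ¬p-holds) = ¬p-holds p-holds

  imp-intro : (σ : Path M) (a b : QForm V)
    → (Sat⋆ M σ a → Sat⋆ M σ b) → Sat⋆ M σ (q-imp a b)
  imp-intro σ a b a⇒b (a-holds , ¬b-holds) = ¬b-holds (a⇒b a-holds)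

  imp-elim : (σ : Path M) (a b : QForm V)
    → Sat⋆ M σ (q-imp a b) → Sat⋆ M σ a → ¬ ¬ Sat⋆ M σ b
  imp-elim σ a b a→b a-holds ¬b-holds = a→b (a-holds , ¬b-holds)

  G-intro : (p : V) (ψ : QForm V) (σ : Path M)
    → (∀ j → Sat⋆ M (suffix σ j) ψ) → Sat⋆ M σ (q-G p ψ)
  G-intro p ψ σ always ¬¬counterexample =
    ¬¬counterexample λ { (j , ¬ψ-at-j , _) → ¬ψ-at-j (always j) }

  G-elim : (p : V) (ψ : QForm V) (σ : Path M)
    → Sat⋆ M σ (q-G p ψ) → ∀ j → ¬ ¬ Sat⋆ M (suffix σ j) ψ
  G-elim p ψ σ Gψ j ¬ψ-at-j =
    Gψ λ ¬counterexample →
      ¬counterexample (j , ¬ψ-at-j , λ i _ → true-holds p (suffix σ i))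

  next-suffix-label : (σ : Path M) (j : ℕ) (p : V)
    → Structure.g M (suffix (suffix σ 1) j at 0) p ≡ Structure.g M (σ at suc j) p
  next-suffix-label σ j p = cong (λ i → Structure.g M (σ at i) p) (+-comm j 1)

  failureFree⇒NG¬ : (v : V) (σ : Path M) → FailureFree v M σ → Sat⋆ M σ (NG¬ v)
  failureFree⇒NG¬ v σ failureFree = G-intro v (q-not (q-atom v)) (suffix σ 1) λ j v-holds →
    not-¬ (trans (sym (next-suffix-label σ j v)) v-holds) (failureFree (suc j) (s≤s z≤n))

  NG¬⇒failureFree : (v : V) (σ : Path M) → Sat⋆ M σ (NG¬ v) → FailureFree v M σ
  NG¬⇒failureFree v σ NG¬v (suc j) _ =
    trans (sym (next-suffix-label σ j v))
          (¬-not (negated-stable (G-elim v (q-not (q-atom v)) (suffix σ 1) NG¬v j)))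

mainTheorem7 : (V : Set) (v : V) (φ : RForm V) (φ⋆ : QForm V)
    → (∀ (M : Structure V) → IsTree M → IsRoCTL v M → (σ : Path M)
    → (Sat v M σ φ → Sat⋆ M σ φ⋆) × (Sat⋆ M σ φ⋆ → Sat v M σ φ))
    → ∀ (M : Structure V) → IsTree M → IsRoCTL v M → (σ : Path M)
    → (Sat v M σ (r-O φ)
    → Sat⋆ M σ (q-A (q-imp (q-next (q-G v (q-not (q-atom v)))) φ⋆)))
    × (Sat⋆ M σ (q-A (q-imp (q-next (q-G v (q-not (q-atom v)))) φ⋆))
    → Sat v M σ (r-O φ))
mainTheorem7 V v φ φ⋆ φ⇔φ⋆ M tree roctl σ = O⇒A , A⇒O
  where
  φ⇒φ⋆ : (π : Path M) → Sat v M π φ → Sat⋆ M π φ⋆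
  φ⇒φ⋆ π = proj₁ (φ⇔φ⋆ M tree roctl π)

  φ⋆⇒φ : (π : Path M) → Sat⋆ M π φ⋆ → Sat v M π φ
  φ⋆⇒φ π = proj₂ (φ⇔φ⋆ M tree roctl π)

  O⇒A : Sat v M σ (r-O φ) → Sat⋆ M σ (q-A (q-imp (NG¬ v) φ⋆))
  O⇒A Oφ π start = imp-intro π (NG¬ v) φ⋆ λ NG¬v →
    φ⇒φ⋆ π (Oφ π start (NG¬⇒failureFree v π NG¬v))

  A⇒O : Sat⋆ M σ (q-A (q-imp (NG¬ v) φ⋆)) → Sat v M σ (r-O φ)
  A⇒O A-imp π start failureFree = sat-stable v M φ π
    (¬¬-map (φ⋆⇒φ π)
      (imp-elim π (NG¬ v) φ⋆ (A-imp π start) (failureFree⇒NG¬ v π failureFree)))
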